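{- Let $\mathcal{P}\subset\mathbb{R}_{\ge0}^n$ be an anti-blocking lattice polytope of dimension $n$, $A=\mathcal{P}\cap\mathbb{Z}^n$, and let $\Lambda=((\mathbf{a}_1,\varepsilon_1),\dots,(\mathbf{a}_r,\varepsilon_r))$ with $\mathbf{a}_j\in A$, $\varepsilon_j\in\{ -1,1\}^n$, be an ordered list such that $\omega(\Lambda)\in\mathbb{Z}_{\ge0}^n$. Then $\mathbf{c}_j(\Lambda)\in A$ for all $1\le j\le r$, $\sum_{j=1}^r\mathbf{c}_j(\Lambda)=\omega(\Lambda)$, and $\mathbf{0}\le\mathbf{c}_j(\Lambda)\le\mathbf{a}_j$ coordinatewise for all $1\le j\le r$.
   Context: A lattice polytope $\mathcal{P}\subset\mathbb{R}_{\ge0}^n$ of dimension $n$ with integer vertices is anti-blocking if for every $\mathbf{y}\in\mathcal{P}$ and $\mathbf{x}\in\mathbb{R}^n$ with $0\le x_i\le y_i$ for all $i$, $\mathbf{x}\in\mathcal{P}$. For $\varepsilon\in\{ -1,1\}^n$, $\varepsilon\mathbf{x}:=(\varepsilon_1x_1,\dots,\varepsilon_nx_n)$. Write $\mathbf{a}_j=(a_{j,1},\dots,a_{j,n})$, $\varepsilon_j=(\varepsilon_{j,1},\dots,\varepsilon_{j,n})$, and $\omega(\Lambda)=(\omega_1(\Lambda),\dots,\omega_n(\Lambda)):=\sum_{j=1}^r\varepsilon_j\mathbf{a}_j$. When $\omega(\Lambda)\ge0$, for each $k\in[n]$ let $P_k(\Lambda)$ be the ordered list $(1,\dots,1,2,\dots,2,\dots,r,\dots,r)$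 in which each $j\in[r]$ appears $a_{j,k}$ times if $\varepsilon_{j,k}=1$ and $0$ times if $\varepsilon_{j,k}=-1$ (its length is at least $\omega_k(\Lambda)$). Let $c_{j,k}(\Lambda)$ be the number of times $j$ appears among the first $\omega_k(\Lambda)$ entries of $P_k(\Lambda)$, and $\mathbf{c}_j(\Lambda):=(c_{j,1}(\Lambda),\dots,c_{j,n}(\Lambda))$. -}

module Defs where

open import Data.Nat as ℕ using (ℕ; zero; suc)
open import Data.Fin using (Fin; zero; suc; _≟_)
open import Data.Integer as ℤ using (ℤ; +_; ∣_∣)
open import Data.Rational as ℚ using (ℚ; 0ℚ; 1ℚ; _/_)
open import Data.Sign using (Sign)
open import Data.List using (List; []; _∷_; concatMap; replicate; take; allFin)
open import Data.Product using (Σ; _×_)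
open import Relation.Nullary using (yes; no)
open import Relation.Binary.PropositionalEquality using (_≡_)

∑ℚ : (m : ℕ) → (Fin m → ℚ) → ℚ
∑ℚ zero    f = 0ℚ
∑ℚ (suc m) f = f zero ℚ.+ ∑ℚ m (λ i → f (suc i))

∑ℤ : (m : ℕ) → (Fin m → ℤ) → ℤ
∑ℤ zero    f = + 0
∑ℤ (suc m) f = f zero ℤ.+ ∑ℤ m (λ i → f (suc i))

toℚ : ℤ → ℚ
toℚ z = z / 1

ℤVec ℚVec : ℕ → Set
ℤVec n = Fin n → ℤ
ℚVec n = Fin n → ℚ

-- A lattice polytope in ℝⁿ, given as the convex hull of finitely many
-- integer points V 0, …, V (m-1).  Points are considered over ℚ.
record LatticePolytope (n : ℕ) : Set where
  constructor polytope
  field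
    m : ℕ
    V : Fin m → ℤVec n

open LatticePolytope public

_∈P_ : ∀ {n} → ℚVec n → LatticePolytope n → Set
x ∈P P = Σ (Fin (m P) → ℚ) λ λ′ →
  (∀ i → 0ℚ ℚ.≤ λ′ i) ×
  (∑ℚ (m P) λ′ ≡ 1ℚ) ×
  (∀ k → x k ≡ ∑ℚ (m P) (λ i → λ′ i ℚ.* toℚ (V P i k)))

Nonneg : ∀ {n} → LatticePolytope n → Set
Nonneg {n} P = ∀ (x : ℚVec n) → x ∈P P → ∀ k → 0ℚ ℚ.≤ x k

AntiBlocking : ∀ {n} → LatticePolytope n → Set
AntiBlocking {n} P = ∀ (x y : ℚVec n) → y ∈P P →
  (∀ k → 0ℚ ℚ.≤ x k) → (∀ k → x k ℚ.≤ y k) → x ∈P P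

-- dim P = n: P contains n+1 affinely independent points
FullDim : ∀ {n} → LatticePolytope n → Set
FullDim {n} P = Σ (Fin (suc n) → ℚVec n) λ p →
  (∀ i → p i ∈P P) ×
  (∀ (μ : Fin n → ℚ) →
     (∀ k → ∑ℚ n (λ i → μ i ℚ.* (p (suc i) k ℚ.- p zero k)) ≡ 0ℚ) →
     ∀ i → μ i ≡ 0ℚ)

_∈A_ : ∀ {n} → ℤVec n → LatticePolytope n → Set
a ∈A P = (λ k → toℚ (a k)) ∈P P

sgn : Sign → ℤ
sgn Sign.+ = + 1
sgn Sign.- = ℤ.-[1+ 0 ]

-- ω(Λ) = ∑ⱼ εⱼ aⱼ   (Λ given by r, a : Fin r → ℤⁿ, ε : Fin r → {±1}ⁿ)
ω : ∀ {n r} → (Fin r → ℤVec n) → (Fin r → Fin n → Sign) → ℤVec n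
ω {n} {r} a ε k = ∑ℤ r (λ j → sgn (ε j k) ℤ.* a j k)

mult : Sign → ℤ → ℕ
mult Sign.+ z = ∣ z ∣
mult Sign.- z = 0

-- P_k(Λ) = (1,…,1,2,…,2,…,r,…,r)
Plist : ∀ {n r} → (Fin r → ℤVec n) → (Fin r → Fin n → Sign) → Fin n → List (Fin r)
Plist {n} {r} a ε k = concatMap (λ j → replicate (mult (ε j k) (a j k)) j) (allFin r)

countFin : ∀ {r} → Fin r → List (Fin r) → ℕ
countFin j [] = 0
countFin j (i ∷ is) with j ≟ i
... | yes _ = suc (countFin j is)
... | no  _ = countFin j is

c : ∀ {n r} → (Fin r → ℤVec n) → (Fin r → Fin n → Sign) → Fin r → ℤVec n
c a ε j k = + countFin j (take ∣ ω a ε k ∣ (Plist a ε k))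

{-# OPTIONS --safe #-}
-- c_{j,k} counts the occurrences of j in a prefix of P_k, so it is at most
-- the multiplicity of j in P_k, which is a_{j,k} or 0.  Hence
-- 0 ≤ c_j ≤ a_j, and c_j ∈ A because P is anti-blocking.  Counting every j in
-- a list gives its length, so ∑_j c_{j,k} is the length of the prefix, i.e.
-- ω_k, since ω_k = ∑_j ε_{j,k} a_{j,k} ≤ ∑_j (multiplicity of j) = |P_k|.
module Submission where

open import Defs
open import Data.Nat as ℕ using (ℕ; zero; suc; z≤n)
open import Data.Fin using (Fin; zero; suc; _≟_; punchIn)
open import Data.Integer using (ℤ; +_; _≤_)
open import Data.Sign using (Sign)
open import Data.Product using (_×_; _,_)
open import Relation.Binary.PropositionalEquality
  using (_≡_; _≢_; refl; sym; trans; cong; cong₂; subst; subst₂; module ≡-Reasoning)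

open import Algebra.Bundles using (CommutativeMonoid)
import Data.Nat.Properties as ℕ
import Data.Nat.Coprimality as Coprime
open import Data.Fin.Properties using (punchInᵢ≢i)
import Data.Integer as ℤ
import Data.Integer.Properties as ℤ
open import Data.List
  using (List; []; _∷_; [_]; _++_; concatMap; replicate; take; tabulate; allFin; length)
open import Data.List.Properties using (length-take)
import Data.Rational as ℚ
open import Data.Rational.Properties using (↥p/↧p≡p; drop-*≤*)
open import Data.Vec.Functional using (Vector)
open import Function using (_∘_)
open import Relation.Nullary using (yes; no; contradiction)

module _ {c ℓ} (M : CommutativeMonoid c ℓ) where
  open CommutativeMonoid M renaming (ε to 0#)
  open import Algebra.Properties.CommutativeMonoid.Sum M

  sum-concentrated : ∀ {n} (t : Vector Carrier n) i →
                     (∀ j → j ≢ i → t j ≈ 0#) → sum t ≈ t i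
  sum-concentrated {suc n} t i t≈0 = begin
    sum t                         ≈⟨ sum-remove t ⟩
    t i ∙ sum (t ∘ punchIn i)     ≈⟨ ∙-congˡ (sum-cong-≋ λ j → t≈0 (punchIn i j) (punchInᵢ≢i i j)) ⟩
    t i ∙ sum {n} (λ _ → 0#)      ≈⟨ ∙-congˡ (sum-replicate-zero n) ⟩
    t i ∙ 0#                      ≈⟨ identityʳ (t i) ⟩
    t i                           ∎
    where open import Relation.Binary.Reasoning.Setoid setoid

open import Algebra.Properties.CommutativeMonoid.Sum ℕ.+-0-commutativeMonoid
  using (sum; sum-cong-≗; sum-replicate-zero; ∑-distrib-+)

∑ℤ-fromℕ : ∀ m (f : Fin m → ℕ) → ∑ℤ m (λ i → + f i) ≡ + sum f
∑ℤ-fromℕ zero    f = refl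
∑ℤ-fromℕ (suc m) f = cong (ℤ._+_ (+ f zero)) (∑ℤ-fromℕ m (f ∘ suc))

∑ℤ-mono-≤ : ∀ m {f g : Fin m → ℤ} → (∀ i → f i ≤ g i) → ∑ℤ m f ≤ ∑ℤ m g
∑ℤ-mono-≤ zero    f≤g = ℤ.≤-refl
∑ℤ-mono-≤ (suc m) f≤g = ℤ.+-mono-≤ (f≤g zero) (∑ℤ-mono-≤ m (f≤g ∘ suc))

module _ {r : ℕ} where

  countFin-++ : ∀ (j : Fin r) xs ys → countFin j (xs ++ ys) ≡ countFin j xs ℕ.+ countFin j ys
  countFin-++ j []       ys = refl
  countFin-++ j (x ∷ xs) ys with j ≟ x
  ... | yes _ = cong suc (countFin-++ j xs ys)
  ... | no  _ = countFin-++ j xs ys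

  countFin-replicate-self : ∀ (j : Fin r) m → countFin j (replicate m j) ≡ m
  countFin-replicate-self j zero = refl
  countFin-replicate-self j (suc m) with j ≟ j
  ... | yes _   = cong suc (countFin-replicate-self j m)
  ... | no  j≢j = contradiction refl j≢j

  countFin-replicate-other : ∀ {j i : Fin r} m → j ≢ i → countFin j (replicate m i) ≡ 0
  countFin-replicate-other zero    j≢i = refl
  countFin-replicate-other {j} {i} (suc m) j≢i with j ≟ i
  ... | yes j≡i = contradiction j≡i j≢i
  ... | no  _   = countFin-replicate-other m j≢i

  countFin-take-≤ : ∀ (j : Fin r) w xs → countFin j (take w xs) ℕ.≤ countFin j xs
  countFin-take-≤ j zero    xs       = z≤n
  countFin-take-≤ j (suc w) []       = z≤n
  countFin-take-≤ j (suc w) (x ∷ xs) with j ≟ x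
  ... | yes _ = ℕ.s≤s (countFin-take-≤ j w xs)
  ... | no  _ = countFin-take-≤ j w xs

  sum-countFin : ∀ (xs : List (Fin r)) → sum (λ j → countFin j xs) ≡ length xs
  sum-countFin []       = sum-replicate-zero r
  sum-countFin (x ∷ xs) = begin
    sum (λ j → countFin j (x ∷ xs))                        ≡⟨ sum-cong-≗ (λ j → countFin-++ j [ x ] xs) ⟩
    sum (λ j → countFin j [ x ] ℕ.+ countFin j xs)         ≡⟨ ∑-distrib-+ (λ j → countFin j [ x ]) _ ⟩
    sum (λ j → countFin j [ x ]) ℕ.+ sum (λ j → countFin j xs)
      ≡⟨ cong₂ ℕ._+_ (sum-concentrated ℕ.+-0-commutativeMonoid _ x (λ j → countFin-replicate-other 1))
                     (sum-countFin xs) ⟩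
    countFin x [ x ] ℕ.+ length xs                         ≡⟨ cong (ℕ._+ length xs) (countFin-replicate-self x 1) ⟩
    suc (length xs)                                        ∎
    where open ≡-Reasoning

  countFin-concatMap-tabulate : ∀ {s} {A : Set} (F : A → List (Fin r)) (g : Fin s → A) j →
    countFin j (concatMap F (tabulate g)) ≡ sum (λ i → countFin j (F (g i)))
  countFin-concatMap-tabulate {zero}  F g j = refl
  countFin-concatMap-tabulate {suc s} F g j =
    trans (countFin-++ j (F (g zero)) (concatMap F (tabulate (g ∘ suc))))
          (cong (countFin j (F (g zero)) ℕ.+_) (countFin-concatMap-tabulate F (g ∘ suc) j))

  countFin-concatMap-replicate : ∀ (m : Fin r → ℕ) j →
    countFin j (concatMap (λ i → replicate (m i) i) (allFin r)) ≡ m j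
  countFin-concatMap-replicate m j = begin
    countFin j (concatMap (λ i → replicate (m i) i) (allFin r))
      ≡⟨ countFin-concatMap-tabulate (λ i → replicate (m i) i) (λ i → i) j ⟩
    sum (λ i → countFin j (replicate (m i) i))
      ≡⟨ sum-concentrated ℕ.+-0-commutativeMonoid _ j (λ i i≢j → countFin-replicate-other (m i) (i≢j ∘ sym)) ⟩
    countFin j (replicate (m j) j)
      ≡⟨ countFin-replicate-self j (m j) ⟩
    m j ∎
    where open ≡-Reasoning

  sum-countFin-take : ∀ {w} (xs : List (Fin r)) → w ℕ.≤ length xs →
                      sum (λ j → countFin j (take w xs)) ≡ w
  sum-countFin-take {w} xs w≤∣xs∣ =
    trans (sum-countFin (take w xs)) (trans (length-take w xs) (ℕ.m≤n⇒m⊓n≡m w≤∣xs∣))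

toℚ≡mkℚ : ∀ z → toℚ z ≡ ℚ.mkℚ z 0 (Coprime.sym (Coprime.1-coprimeTo ℤ.∣ z ∣))
toℚ≡mkℚ z = ↥p/↧p≡p _

toℚ-mono-≤ : ∀ {z w} → z ≤ w → toℚ z ℚ.≤ toℚ w
toℚ-mono-≤ {z} {w} z≤w rewrite toℚ≡mkℚ z | toℚ≡mkℚ w =
  ℚ.*≤* (subst₂ _≤_ (sym (ℤ.*-identityʳ z)) (sym (ℤ.*-identityʳ w)) z≤w)

toℚ-cancel-≤ : ∀ {z w} → toℚ z ℚ.≤ toℚ w → z ≤ w
toℚ-cancel-≤ {z} {w} q≤q rewrite toℚ≡mkℚ z | toℚ≡mkℚ w =
  subst₂ _≤_ (ℤ.*-identityʳ z) (ℤ.*-identityʳ w) (drop-*≤* q≤q)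

∈A-nonneg : ∀ {n} {P : LatticePolytope n} {a} → Nonneg P → a ∈A P → ∀ k → + 0 ≤ a k
∈A-nonneg nonneg a∈A k = toℚ-cancel-≤ (nonneg _ a∈A k)

∈A-downward : ∀ {n} {P : LatticePolytope n} {a b} → AntiBlocking P → a ∈A P →
              (∀ k → + 0 ≤ b k) → (∀ k → b k ≤ a k) → b ∈A P
∈A-downward antiBlocking a∈A 0≤b b≤a = antiBlocking _ _ a∈A (toℚ-mono-≤ ∘ 0≤b) (toℚ-mono-≤ ∘ b≤a)

mult-≤ : ∀ e {z} → + 0 ≤ z → + mult e z ≤ z
mult-≤ Sign.+ 0≤z = ℤ.≤-reflexive (ℤ.0≤i⇒+∣i∣≡i 0≤z)
mult-≤ Sign.- 0≤z = 0≤z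

sgn*-≤-mult : ∀ e {z} → + 0 ≤ z → sgn e ℤ.* z ≤ + mult e z
sgn*-≤-mult Sign.+ {z} 0≤z = ℤ.≤-reflexive (trans (ℤ.*-identityˡ z) (sym (ℤ.0≤i⇒+∣i∣≡i 0≤z)))
sgn*-≤-mult Sign.- {z} 0≤z = subst (_≤ + 0) (sym (ℤ.-1*i≡-i z)) (ℤ.neg-mono-≤ 0≤z)

module _ {n r} (a : Fin r → ℤVec n) (ε : Fin r → Fin n → Sign) (a≥0 : ∀ j k → + 0 ≤ a j k) where

  countFin-Plist : ∀ k j → countFin j (Plist a ε k) ≡ mult (ε j k) (a j k)
  countFin-Plist k = countFin-concatMap-replicate (λ j → mult (ε j k) (a j k))

  c≤a : ∀ j k → c a ε j k ≤ a j k
  c≤a j k = ℤ.≤-trans (ℤ.+≤+ (ℕ.≤-trans c≤count (ℕ.≤-reflexive (countFin-Plist k j))))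
                      (mult-≤ (ε j k) (a≥0 j k))
    where
    c≤count : countFin j (take ℤ.∣ ω a ε k ∣ (Plist a ε k)) ℕ.≤ countFin j (Plist a ε k)
    c≤count = countFin-take-≤ j ℤ.∣ ω a ε k ∣ (Plist a ε k)

  ω≤length-Plist : ∀ k → ω a ε k ≤ + length (Plist a ε k)
  ω≤length-Plist k = begin
    ω a ε k                                  ≤⟨ ∑ℤ-mono-≤ r (λ j → sgn*-≤-mult (ε j k) (a≥0 j k)) ⟩
    ∑ℤ r (λ j → + mult (ε j k) (a j k))      ≡⟨ ∑ℤ-fromℕ r _ ⟩
    + sum (λ j → mult (ε j k) (a j k))       ≡⟨ cong +_ (sum-cong-≗ (countFin-Plist k)) ⟨
    + sum (λ j → countFin j (Plist a ε k))   ≡⟨ cong +_ (sum-countFin (Plist a ε k)) ⟩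
    + length (Plist a ε k)                   ∎
    where open ℤ.≤-Reasoning

  ∑c≡ω : (∀ k → + 0 ≤ ω a ε k) → ∀ k → ∑ℤ r (λ j → c a ε j k) ≡ ω a ε k
  ∑c≡ω ω≥0 k = begin
    ∑ℤ r (λ j → c a ε j k)                   ≡⟨ ∑ℤ-fromℕ r _ ⟩
    + sum (λ j → countFin j (take ∣ω∣ L))   ≡⟨ cong +_ (sum-countFin-take L ∣ω∣≤∣L∣) ⟩
    + ∣ω∣                                    ≡⟨ +∣ω∣≡ω ⟩
    ω a ε k                                  ∎
    where
    open ≡-Reasoning
    L = Plist a ε k
    ∣ω∣ = ℤ.∣ ω a ε k ∣
    +∣ω∣≡ω : + ∣ω∣ ≡ ω a ε k
    +∣ω∣≡ω = ℤ.0≤i⇒+∣i∣≡i (ω≥0 k)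
    ∣ω∣≤∣L∣ : ∣ω∣ ℕ.≤ length L
    ∣ω∣≤∣L∣ = ℤ.drop‿+≤+ (subst (_≤ + length L) (sym +∣ω∣≡ω) (ω≤length-Plist k))

lemma3p5 : (n : ℕ) (P : LatticePolytope n) →
    Nonneg P → AntiBlocking P → FullDim P →
    (r : ℕ) (a : Fin r → ℤVec n) (ε : Fin r → Fin n → Sign) →
    (∀ j → a j ∈A P) →
    (∀ k → + 0 ≤ ω a ε k) →
    (∀ j → c a ε j ∈A P) ×
    (∀ k → ∑ℤ r (λ j → c a ε j k) ≡ ω a ε k) ×
    (∀ j k → (+ 0 ≤ c a ε j k) × (c a ε j k ≤ a j k))
lemma3p5 n P nonneg antiBlocking _ r a ε a∈A ω≥0 =
  (λ j → ∈A-downward {P = P} antiBlocking (a∈A j) (λ k → 0≤c j k) (c≤a a ε a≥0 j)) ,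
  ∑c≡ω a ε a≥0 ω≥0 ,
  (λ j k → 0≤c j k , c≤a a ε a≥0 j k)
  where
  a≥0 : ∀ j k → + 0 ≤ a j k
  a≥0 j = ∈A-nonneg {P = P} nonneg (a∈A j)
  0≤c : ∀ j k → + 0 ≤ c a ε j k
  0≤c j k = ℤ.+≤+ z≤n
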